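{- Let $(X,Z,D)$ be a feasible solution of the STT LP for a tree topology $U$. For every positive integer $k$, the depth vector $D$ has at most $k$ entries with value strictly smaller than $\frac{k}{k+1}$. In particular at most one coordinate is smaller than $\frac12$, at most two are smaller than $\frac23$, etc.
   Context: For a tree $U$ and distinct nodes $i,j$, $(i\leftrightsquigarrow j)$ denotes the set of nodes strictly between $i$ and $j$ on the $U$-path. The STT LP for $U$ has variables $D_i$ ($i\in U$), $X_{ij}$ ($i\ne j$), $Z_{kij}=Z_{kji}$ ($k\in(i\leftrightsquigarrow j)$), and constraints: $X_{ij}\ge0$, $Z_{kij}\ge0$; for all $i\ne j$: $X_{ij}+X_{ji}+\sum_{k\in(i\leftrightsquigarrow j)}Z_{kij}\ge1$; $Z_{kij}\le X_{ki}$, $Z_{kij}\le X_{kj}$; $D_i\ge\sum_{j\ne i}X_{ji}$.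
   Formalization: The feasible solution $(X,Z,D)$ has only rational entries rather than non-negative real values. -}

module Defs where

open import Data.Nat using (ℕ; suc; _≥_)
open import Data.Fin using (Fin; _≟_)
open import Data.List using (List; []; _∷_; [_]; length; filter; map; foldr)
open import Data.List.Relation.Unary.Unique.Propositional using (Unique)
open import Data.List.Membership.Propositional using (_∈_)
open import Data.List.Relation.Binary.Pointwise using ()
open import Data.Fin.Base using ()
open import Data.List.Base using ()
open import Data.Product using (Σ; ∃; _×_; _,_)
open import Data.Empty using (⊥)
open import Relation.Nullary using (¬_; ¬?)
open import Relation.Binary.PropositionalEquality using (_≡_)
open import Data.Integer using (+_)
open import Data.Rational using (ℚ; _+_; _≤_; _<_; 0ℚ; 1ℚ; _/_)
open import Data.Rational.Properties using (_<?_)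
import Data.List as L

data Walk {n : ℕ} (E : Fin n → Fin n → Set) : Fin n → Fin n → List (Fin n) → Set where
  here : ∀ {i} → Walk E i i [ i ]
  step : ∀ {i k j p} → E i k → Walk E k j p → Walk E i j (i ∷ p)

SimplePath : {n : ℕ} → (Fin n → Fin n → Set) → Fin n → Fin n → List (Fin n) → Set
SimplePath E i j p = Walk E i j p × Unique p

HasCycle : {n : ℕ} → (Fin n → Fin n → Set) → Set
HasCycle {n} E = Σ (Fin n) λ i → Σ (Fin n) λ j → Σ (List (Fin n)) λ p →
  SimplePath E i j p × length p ≥ 3 × E j i

record IsTree {n : ℕ} (E : Fin n → Fin n → Set) : Set where
  field
    symmetric   : ∀ i j → E i j → E j i
    irreflexive : ∀ i → ¬ E i i
    connected   : ∀ i j → ∃ λ p → Walk E i j p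
    acyclic     : ¬ HasCycle E

dropLast : {A : Set} → List A → List A
dropLast []           = []
dropLast (x ∷ [])     = []
dropLast (x ∷ y ∷ ys) = x ∷ dropLast (y ∷ ys)

interior : {A : Set} → List A → List A
interior []       = []
interior (x ∷ xs) = dropLast xs

-- k ∈ (i ⇝ j): k lies strictly between i and j on the U-path
-- (in a tree the simple path from i to j is unique)
Between : {n : ℕ} → (Fin n → Fin n → Set) → Fin n → Fin n → Fin n → Set
Between {n} E k i j = Σ (List (Fin n)) λ p → SimplePath E i j p × k ∈ interior p

sumℚ : List ℚ → ℚ
sumℚ = foldr _+_ 0ℚ

record STTFeasible {n : ℕ} (E : Fin n → Fin n → Set)
                   (D : Fin n → ℚ) (X : Fin n → Fin n → ℚ)
                   (Z : Fin n → Fin n → Fin n → ℚ) : Set where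
  field
    X-nonneg : ∀ i j → ¬ (i ≡ j) → 0ℚ ≤ X i j
    Z-nonneg : ∀ k i j → ¬ (i ≡ j) → Between E k i j → 0ℚ ≤ Z k i j
    Z-symm   : ∀ k i j → ¬ (i ≡ j) → Between E k i j → Z k i j ≡ Z k j i
    cover    : ∀ i j → ¬ (i ≡ j) → ∀ p → SimplePath E i j p →
               1ℚ ≤ X i j + X j i + sumℚ (map (λ k → Z k i j) (interior p))
    Z≤Xki    : ∀ k i j → ¬ (i ≡ j) → Between E k i j → Z k i j ≤ X k i
    Z≤Xkj    : ∀ k i j → ¬ (i ≡ j) → Between E k i j → Z k i j ≤ X k j
    depth    : ∀ i → sumℚ (map (λ j → X j i) (filter (λ j → ¬? (j ≟ i)) (L.allFin n))) ≤ D i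

countBelow : {n : ℕ} → (Fin n → ℚ) → ℚ → ℕ
countBelow {n} D t = length (filter (λ i → D i <? t) (L.allFin n))

-- Fix a node r. For any other node i, the cover constraint for the pair {i, r}, with each
-- Z_kir bounded by X_ki, gives 1 ≤ X_ir + X_ri + Σ_k X_ki ≤ X_ir + D_i, because r and the
-- interior nodes k of the U-path are distinct and different from i. Summing this over k
-- further nodes i and bounding Σ_i X_ir by D_r shows that any k + 1 distinct nodes have total
-- depth at least k, which is impossible if each of them has depth below k/(k+1).
module Submission where

open import Defs
open import Data.Nat using (ℕ; suc; _≤_)
open import Data.Fin using (Fin)
open import Data.Integer using (+_)
open import Data.Rational using (ℚ; _/_)

open import Algebra.Bundles using (CommutativeMonoid)
import Algebra.Properties.CommutativeSemigroup as CommutativeSemigroupProperties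
open import Data.Empty using (⊥-elim)
import Data.Fin as Fin
import Data.Integer as ℤ
import Data.Integer.Properties as ℤ
open import Data.List using (List; []; _∷_; _∷ʳ_; map; filter; length; allFin)
open import Data.List.Membership.Propositional using (_∈_)
open import Data.List.Membership.Propositional.Properties using (∈-filter⁺; ∈-filter⁻; ∈-allFin)
open import Data.List.Relation.Binary.Subset.Propositional using (_⊆_)
open import Data.List.Relation.Unary.All as All using (All; []; _∷_)
import Data.List.Relation.Unary.All.Properties as All
open import Data.List.Relation.Unary.AllPairs using ([]; _∷_)
open import Data.List.Relation.Unary.Any using (here; there; _─_; any?)
open import Data.List.Relation.Unary.Unique.Propositional using (Unique)
import Data.List.Relation.Unary.Unique.Propositional.Properties as Unique
import Data.Nat as ℕ
import Data.Nat.Properties as ℕ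
open import Data.Product using (∃; _,_; proj₂)
import Data.Rational as ℚ
open import Data.Rational using (_+_; _*_; 0ℚ; 1ℚ; toℚᵘ)
open import Data.Rational.Properties hiding (_≟_)
open import Data.Rational.Unnormalised as ℚᵘ using (mkℚᵘ; *≡*)
import Data.Rational.Unnormalised.Properties as ℚᵘ
open import Relation.Binary.PropositionalEquality
open import Relation.Nullary using (Dec; ¬?; yes; no)

open CommutativeSemigroupProperties (CommutativeMonoid.commutativeSemigroup +-0-commutativeMonoid)
  using (x∙yz≈y∙xz; interchange)

[1+m]/1≡1+m/1 : ∀ m → (+ suc m) / 1 ≡ 1ℚ + (+ m) / 1
[1+m]/1≡1+m/1 m = toℚᵘ-injective (begin-equality
  toℚᵘ ((+ suc m) / 1)           ≃⟨ toℚᵘ-fromℚᵘ (mkℚᵘ (+ suc m) 0) ⟩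
  mkℚᵘ (+ suc m) 0               ≃⟨ *≡* (cong (λ z → (+ 1 ℤ.+ z) ℤ.* + 1) (sym (ℤ.*-identityʳ (+ m)))) ⟩
  ℚᵘ.1ℚᵘ ℚᵘ.+ mkℚᵘ (+ m) 0       ≃⟨ ℚᵘ.+-congʳ ℚᵘ.1ℚᵘ (ℚᵘ.≃-sym (toℚᵘ-fromℚᵘ (mkℚᵘ (+ m) 0))) ⟩
  toℚᵘ 1ℚ ℚᵘ.+ toℚᵘ ((+ m) / 1)  ≃⟨ ℚᵘ.≃-sym (toℚᵘ-homo-+ 1ℚ ((+ m) / 1)) ⟩
  toℚᵘ (1ℚ + (+ m) / 1)          ∎)
  where open ℚᵘ.≤-Reasoning

m<[1+m]k/[1+k]⇒m<k : ∀ m k → (+ m) / 1 ℚ.< ((+ suc m) / 1) * ((+ k) / suc k) → m ℕ.< k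
m<[1+m]k/[1+k]⇒m<k m k m<[1+m]k/[1+k] = ℕ.+-cancelʳ-< (m ℕ.* k) m k m+mk<k+mk
  where
  cross-multiplied : mkℚᵘ (+ m) 0 ℚᵘ.< mkℚᵘ (+ suc m ℤ.* + k) k
  cross-multiplied = begin-strict
    mkℚᵘ (+ m) 0                                    ≃⟨ ℚᵘ.≃-sym (toℚᵘ-fromℚᵘ (mkℚᵘ (+ m) 0)) ⟩
    toℚᵘ ((+ m) / 1)                                <⟨ toℚᵘ-mono-< m<[1+m]k/[1+k] ⟩
    toℚᵘ (((+ suc m) / 1) * ((+ k) / suc k))        ≃⟨ toℚᵘ-homo-* ((+ suc m) / 1) ((+ k) / suc k) ⟩
    toℚᵘ ((+ suc m) / 1) ℚᵘ.* toℚᵘ ((+ k) / suc k) ≃⟨ ℚᵘ.*-cong (toℚᵘ-fromℚᵘ (mkℚᵘ (+ suc m) 0))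
                                                                  (toℚᵘ-fromℚᵘ (mkℚᵘ (+ k) k)) ⟩
    mkℚᵘ (+ suc m) 0 ℚᵘ.* mkℚᵘ (+ k) k              ≃⟨ ℚᵘ.≃-reflexive (cong (mkℚᵘ (+ suc m ℤ.* + k))
                                                                                 (ℕ.+-identityʳ k)) ⟩
    mkℚᵘ (+ suc m ℤ.* + k) k                        ∎
    where open ℚᵘ.≤-Reasoning
  m*[1+k]<[1+m]*k : m ℕ.* suc k ℕ.< suc m ℕ.* k
  m*[1+k]<[1+m]*k = ℤ.drop‿+<+ (subst₂ ℤ._<_
    (sym (ℤ.pos-* m (suc k)))
    (trans (ℤ.*-identityʳ (+ suc m ℤ.* + k)) (sym (ℤ.pos-* (suc m) k)))
    (ℚᵘ.drop-*<* cross-multiplied))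
  m+mk<k+mk : m ℕ.+ m ℕ.* k ℕ.< k ℕ.+ m ℕ.* k
  m+mk<k+mk = subst (ℕ._< k ℕ.+ m ℕ.* k) (ℕ.*-suc m k) m*[1+k]<[1+m]*k

module _ {a} {A : Set a} where

  ∑ : (A → ℚ) → List A → ℚ
  ∑ f xs = sumℚ (map f xs)

  ∑-nonneg : ∀ {f : A → ℚ} {xs} → All (λ x → 0ℚ ℚ.≤ f x) xs → 0ℚ ℚ.≤ ∑ f xs
  ∑-nonneg []           = ≤-refl
  ∑-nonneg (0≤fx ∷ 0≤f) = +-mono-≤ 0≤fx (∑-nonneg 0≤f)

  ∑-mono-≤ : ∀ {f g : A → ℚ} {xs} → All (λ x → f x ℚ.≤ g x) xs → ∑ f xs ℚ.≤ ∑ g xs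
  ∑-mono-≤ []             = ≤-refl
  ∑-mono-≤ (fx≤gx ∷ f≤g) = +-mono-≤ fx≤gx (∑-mono-≤ f≤g)

  ∑-mono-< : ∀ {f g : A → ℚ} {x xs} → All (λ y → f y ℚ.< g y) (x ∷ xs) →
             ∑ f (x ∷ xs) ℚ.< ∑ g (x ∷ xs)
  ∑-mono-< (fx<gx ∷ f<g) = +-mono-<-≤ fx<gx (∑-mono-≤ (All.map <⇒≤ f<g))

  ∑-distrib-+ : ∀ (f g : A → ℚ) xs → ∑ (λ x → f x + g x) xs ≡ ∑ f xs + ∑ g xs
  ∑-distrib-+ f g []       = refl
  ∑-distrib-+ f g (x ∷ xs) = begin
    (f x + g x) + ∑ (λ y → f y + g y) xs  ≡⟨ cong (_+_ (f x + g x)) (∑-distrib-+ f g xs) ⟩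
    (f x + g x) + (∑ f xs + ∑ g xs)       ≡⟨ interchange (f x) (g x) (∑ f xs) (∑ g xs) ⟩
    (f x + ∑ f xs) + (g x + ∑ g xs)       ∎
    where open ≡-Reasoning

  ∑-∷ʳ : ∀ (f : A → ℚ) xs x → ∑ f (xs ∷ʳ x) ≡ f x + ∑ f xs
  ∑-∷ʳ f []       x = refl
  ∑-∷ʳ f (y ∷ xs) x = begin
    f y + ∑ f (xs ∷ʳ x)     ≡⟨ cong (_+_ (f y)) (∑-∷ʳ f xs x) ⟩
    f y + (f x + ∑ f xs)    ≡⟨ x∙yz≈y∙xz (f y) (f x) (∑ f xs) ⟩
    f x + (f y + ∑ f xs)    ∎
    where open ≡-Reasoning

  ∑-const : ∀ (c : ℚ) (xs : List A) → ∑ (λ _ → c) xs ≡ ((+ length xs) / 1) * c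
  ∑-const c []       = sym (*-zeroˡ c)
  ∑-const c (x ∷ xs) = begin
    c + ∑ (λ _ → c) xs                     ≡⟨ cong (_+_ c) (∑-const c xs) ⟩
    c + ((+ length xs) / 1) * c            ≡⟨ cong (_+ ((+ length xs) / 1) * c) (sym (*-identityˡ c)) ⟩
    1ℚ * c + ((+ length xs) / 1) * c       ≡⟨ sym (*-distribʳ-+ c 1ℚ ((+ length xs) / 1)) ⟩
    (1ℚ + (+ length xs) / 1) * c           ≡⟨ cong (_* c) (sym ([1+m]/1≡1+m/1 (length xs))) ⟩
    ((+ suc (length xs)) / 1) * c          ∎
    where open ≡-Reasoning

  ∑-─ : ∀ (f : A → ℚ) {x xs} (x∈xs : x ∈ xs) → ∑ f xs ≡ f x + ∑ f (xs ─ x∈xs)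
  ∑-─ f (here refl) = refl
  ∑-─ f {x} {y ∷ xs} (there x∈xs) = begin
    f y + ∑ f xs                   ≡⟨ cong (_+_ (f y)) (∑-─ f x∈xs) ⟩
    f y + (f x + ∑ f (xs ─ x∈xs))  ≡⟨ x∙yz≈y∙xz (f y) (f x) (∑ f (xs ─ x∈xs)) ⟩
    f x + (f y + ∑ f (xs ─ x∈xs))  ∎
    where open ≡-Reasoning

  ∈-─ : ∀ {x y} {xs : List A} (x∈xs : x ∈ xs) → y ∈ xs → x ≢ y → y ∈ (xs ─ x∈xs)
  ∈-─ (here refl)  (here refl)  x≢y = ⊥-elim (x≢y refl)
  ∈-─ (here refl)  (there y∈xs) _   = y∈xs
  ∈-─ (there _)    (here refl)  _   = here refl
  ∈-─ (there x∈xs) (there y∈xs) x≢y = there (∈-─ x∈xs y∈xs x≢y)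

  ∑-mono-⊆ : ∀ {f : A → ℚ} {xs ys} → Unique xs → xs ⊆ ys → All (λ y → 0ℚ ℚ.≤ f y) ys →
             ∑ f xs ℚ.≤ ∑ f ys
  ∑-mono-⊆ [] _ 0≤f = ∑-nonneg 0≤f
  ∑-mono-⊆ {f} {x ∷ xs} {ys} (x∉xs ∷ xs-unique) xs⊆ys 0≤f = begin
    f x + ∑ f xs            ≤⟨ +-monoʳ-≤ (f x) (∑-mono-⊆ xs-unique xs⊆rest (All.─⁺ x∈ys 0≤f)) ⟩
    f x + ∑ f (ys ─ x∈ys)   ≡⟨ sym (∑-─ f x∈ys) ⟩
    ∑ f ys                  ∎
    where
    open ≤-Reasoning
    x∈ys : x ∈ ys
    x∈ys = xs⊆ys (here refl)
    xs⊆rest : xs ⊆ (ys ─ x∈ys)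
    xs⊆rest y∈xs = ∈-─ x∈ys (xs⊆ys (there y∈xs)) (All.lookup x∉xs y∈xs)

module _ {n : ℕ} where

  others : Fin n → List (Fin n)
  others i = filter (λ j → ¬? (j Fin.≟ i)) (allFin n)

  ∈-others⁺ : ∀ {i j} → j ≢ i → j ∈ others i
  ∈-others⁺ {i} {j} = ∈-filter⁺ (λ j → ¬? (j Fin.≟ i)) (∈-allFin j)

  ∈-others⁻ : ∀ {i j} → j ∈ others i → j ≢ i
  ∈-others⁻ {i} j∈others = proj₂ (∈-filter⁻ (λ j → ¬? (j Fin.≟ i)) {xs = allFin n} j∈others)

module _ {n : ℕ} {E : Fin n → Fin n → Set} where

  walk-∷ʳ : ∀ {i j p} → Walk E i j p → p ≡ dropLast p ∷ʳ j
  walk-∷ʳ here                   = refl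
  walk-∷ʳ (step _ here)          = refl
  walk-∷ʳ (step {i = i} _ w@(step _ _)) = cong (i ∷_) (walk-∷ʳ w)

  simplePath-suffix : ∀ {i j p x} → SimplePath E i j p → x ∈ p → ∃ λ q → SimplePath E x j q
  simplePath-suffix path@(here , _)       (here refl) = _ , path
  simplePath-suffix path@(step _ _ , _)   (here refl) = _ , path
  simplePath-suffix (step _ w , _ ∷ unique) (there x∈p) = simplePath-suffix (w , unique) x∈p

  walk⇒simplePath : ∀ {i j p} → Walk E i j p → ∃ λ q → SimplePath E i j q
  walk⇒simplePath here = _ , here , [] ∷ []
  walk⇒simplePath {i} (step e w) with walk⇒simplePath w
  ... | q , path@(w₁ , unique) with any? (i Fin.≟_) q
  ...   | yes i∈q = simplePath-suffix path i∈q
  ...   | no  i∉q = i ∷ q , step e w₁ , All.¬Any⇒All¬ q i∉q ∷ unique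

module _ {n : ℕ} {E : Fin n → Fin n → Set} {D : Fin n → ℚ} {X : Fin n → Fin n → ℚ}
         {Z : Fin n → Fin n → Fin n → ℚ} (feasible : STTFeasible E D X Z) where

  open STTFeasible feasible

  inflow≤depth : ∀ {i L} → Unique (i ∷ L) → ∑ (λ j → X j i) L ℚ.≤ D i
  inflow≤depth {i} {L} (i∉L ∷ L-unique) = ≤-trans (∑-mono-⊆ L-unique L⊆others inflow-nonneg) (depth i)
    where
    L⊆others : L ⊆ others i
    L⊆others j∈L = ∈-others⁺ (≢-sym (All.lookup i∉L j∈L))
    inflow-nonneg : All (λ j → 0ℚ ℚ.≤ X j i) (others i)
    inflow-nonneg = All.tabulate λ j∈others → X-nonneg _ i (∈-others⁻ j∈others)

  1≤X+D-along : ∀ {i r p} → i ≢ r → SimplePath E i r p → 1ℚ ℚ.≤ X i r + D i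
  1≤X+D-along i≢r (here , _) = ⊥-elim (i≢r refl)
  1≤X+D-along {i} {r} i≢r path@(step {p = q} _ w , unique) = begin
    1ℚ                                      ≤⟨ cover i r i≢r (i ∷ q) path ⟩
    X i r + X r i + ∑ (λ k → Z k i r) I     ≡⟨ +-assoc (X i r) (X r i) (∑ (λ k → Z k i r) I) ⟩
    X i r + (X r i + ∑ (λ k → Z k i r) I)   ≤⟨ +-monoʳ-≤ (X i r) (+-monoʳ-≤ (X r i) (∑-mono-≤ Z≤X)) ⟩
    X i r + (X r i + ∑ (λ k → X k i) I)     ≡⟨ cong (_+_ (X i r)) inflow-along ⟩
    X i r + ∑ (λ k → X k i) q               ≤⟨ +-monoʳ-≤ (X i r) (inflow≤depth unique) ⟩
    X i r + D i                             ∎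
    where
    open ≤-Reasoning
    I : List (Fin n)
    I = interior (i ∷ q)
    Z≤X : All (λ k → Z k i r ℚ.≤ X k i) I
    Z≤X = All.tabulate λ k∈I → Z≤Xki _ i r i≢r (i ∷ q , path , k∈I)
    inflow-along : X r i + ∑ (λ k → X k i) I ≡ ∑ (λ k → X k i) q
    inflow-along = sym (trans (cong (∑ (λ k → X k i)) (walk-∷ʳ w)) (∑-∷ʳ (λ k → X k i) I r))

  1≤X+D : IsTree E → ∀ {i r} → i ≢ r → 1ℚ ℚ.≤ X i r + D i
  1≤X+D tree {i} {r} i≢r = 1≤X+D-along i≢r (proj₂ (walk⇒simplePath (proj₂ (IsTree.connected tree i r))))

  length≤∑depth : IsTree E → ∀ {r S} → Unique (r ∷ S) → (+ length S) / 1 ℚ.≤ ∑ D (r ∷ S)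
  length≤∑depth tree {r} {S} unique@(r∉S ∷ _) = begin
    (+ length S) / 1             ≡⟨ sym (trans (∑-const 1ℚ S) (*-identityʳ ((+ length S) / 1))) ⟩
    ∑ (λ _ → 1ℚ) S               ≤⟨ ∑-mono-≤ (All.map (λ r≢i → 1≤X+D tree (≢-sym r≢i)) r∉S) ⟩
    ∑ (λ i → X i r + D i) S      ≡⟨ ∑-distrib-+ (λ i → X i r) D S ⟩
    ∑ (λ i → X i r) S + ∑ D S    ≤⟨ +-monoˡ-≤ (∑ D S) (inflow≤depth unique) ⟩
    D r + ∑ D S                  ∎
    where open ≤-Reasoning

  below-k/[1+k]⇒length≤k : IsTree E → ∀ k {B} → Unique B → All (λ i → D i ℚ.< (+ k) / suc k) B → length B ≤ k
  below-k/[1+k]⇒length≤k tree k []              _     = ℕ.z≤n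
  below-k/[1+k]⇒length≤k tree k {r ∷ S} unique below = m<[1+m]k/[1+k]⇒m<k (length S) k (begin-strict
    (+ length S) / 1                         ≤⟨ length≤∑depth tree unique ⟩
    ∑ D (r ∷ S)                              <⟨ ∑-mono-< below ⟩
    ∑ (λ _ → (+ k) / suc k) (r ∷ S)          ≡⟨ ∑-const ((+ k) / suc k) (r ∷ S) ⟩
    ((+ suc (length S)) / 1) * ((+ k) / suc k) ∎)
    where open ≤-Reasoning

-- The bound also holds for k = 0.
corollary3p2 : (n : ℕ) (E : Fin n → Fin n → Set) → IsTree E →
    (D : Fin n → ℚ) (X : Fin n → Fin n → ℚ) (Z : Fin n → Fin n → Fin n → ℚ) →
    STTFeasible E D X Z →
    (k : ℕ) → 1 ≤ k → countBelow D ((+ k) / suc k) ≤ k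
corollary3p2 n E tree D X Z feasible k _ =
  below-k/[1+k]⇒length≤k feasible tree k (Unique.filter⁺ below? (Unique.allFin⁺ n)) (All.all-filter below? (allFin n))
  where
  below? : ∀ i → Dec (D i ℚ.< (+ k) / suc k)
  below? i = D i <? (+ k) / suc k
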